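{- Let $\Gamma$ be a finite, connected, simple, undirected graph with at least one edge, $G$ a group, and $s_1,s_2\in Z(G)$ with $s_1^2=s_2^2=1_G$. For $H_1,H_2\in\mathcal H_\Gamma$ the following are equivalent: (1) $\Psi(H_1)=\Psi(H_2)$ and $\Psi_L(H_1)=\Psi_L(H_2)$; (2) $H_1\sim_l H_2$ and $H_1\sim_r H_2$; (3) there exists $(f,g)\in St_{l\times r}(H_1)$ such that $H_2=\underline f^{\,*}H_1$; (4) there exists $(f,g)\in St_{l\times r}(H_1)$ such that $H_2=H_1\underline g$.
   Context: Fix orders $V_\Gamma=\{v_1,\dots,v_n\}$, $E_\Gamma=\{e_1,\dots,e_m\}$; write $v_i\in e_j$ if $v_i$ is an endpoint of $e_j$, and $e_i\cap e_j$ for the common endpoint of distinct edges sharing a vertex. $\mathbb CG$ is the complex group algebra with involution $(\sum f_xx)^*=\sum\overline{f_x}x^{ -1}$, and $(A^*)_{i,j}=(A_{j,i})^*$. A $G$-phase of $\Gamma$ is $H\in M_{n\times m}(\mathbb CG)$ with $H_{i,j}\in G$ if $v_i\in e_j$ and $H_{i,j}=0$ otherwise; $\mathcal H_\Gamma$ is their set. For $g\in G^k$, $\underline g=\mathrm{diag}(g_1,\dots,g_k)$. $H_1\sim_r H_2$ means $H_1=H_2\underline g$ for some $g\in G^m$; $H_1\sim_l H_2$ means $H_1=\underline f^{\,*}H_2$ for some $f\in G^n$. $St_{l\times r}(H)=\{(f,g)\in G^n\times G^m:\underline f^{\,*}H\underline g=H\}$. $\Psi(H)$ is the gain function on $\Gamma$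 with $\Psi(H)(v_i,v_j)=s_1H_{i,k}H_{j,k}^{ -1}$ for $e_k=\{v_i,v_j\}$. The line graph $L(\Gamma)$ has vertex set $E_\Gamma$, $e_i\sim e_j$ iff they share an endpoint, and $\Psi_L(H)$ is the gain function on $L(\Gamma)$ with $\Psi_L(H)(e_i,e_j)=s_2H_{k,i}^{ -1}H_{k,j}$ for $v_k=e_i\cap e_j$. (A gain function assigns to each ordered pair of adjacent vertices an element of $G$, inverting under reversal.) -}

module Defs where

open import Level using (Level; _⊔_)
open import Data.Nat using (ℕ; _≥_)
open import Data.Fin using (Fin)
open import Data.Product using (_×_; _,_; proj₁; proj₂; Σ; ∃)
open import Data.Sum using (_⊎_)
open import Relation.Nullary using (¬_)
open import Relation.Binary.PropositionalEquality using (_≡_)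
open import Algebra.Bundles using (Group)

record Graph : Set where
  field
    n    : ℕ
    m    : ℕ
    ends : Fin m → Fin n × Fin n

  _∈ₑ_ : Fin n → Fin m → Set
  i ∈ₑ j = i ≡ proj₁ (ends j) ⊎ i ≡ proj₂ (ends j)

  Adj : Fin n → Fin n → Set
  Adj a b = ∃ λ k → (a ∈ₑ k) × (b ∈ₑ k) × ¬ (a ≡ b)

open Graph public

data Walk (Γ : Graph) : Fin (n Γ) → Fin (n Γ) → Set where
  here : ∀ {a} → Walk Γ a a
  step : ∀ {a b c} → Adj Γ a b → Walk Γ b c → Walk Γ a c

Simple : Graph → Set
Simple Γ =
  (∀ k → ¬ (proj₁ (ends Γ k) ≡ proj₂ (ends Γ k))) ×
  (∀ k k' → (_∈ₑ_ Γ (proj₁ (ends Γ k)) k') → (_∈ₑ_ Γ (proj₂ (ends Γ k)) k') → k ≡ k')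

Connected : Graph → Set
Connected Γ = ∀ a b → Walk Γ a b

HasEdge : Graph → Set
HasEdge Γ = m Γ ≥ 1

module Phases {c ℓ : Level} (Γ : Graph) (G : Group c ℓ) where
  open Group G public

  -- A G-phase H ∈ M_{n×m}(ℂG): its entries H_{i,j} ∈ G at incident positions
  -- v_i ∈ e_j; the entries at non-incident positions (which are 0 in the paper)
  -- are never inspected.
  Phase : Set c
  Phase = Fin (n Γ) → Fin (m Γ) → Carrier

  _≈ₕ_ : Phase → Phase → Set (ℓ)
  H₁ ≈ₕ H₂ = ∀ i j → _∈ₑ_ Γ i j → H₁ i j ≈ H₂ i j

  lmul : (Fin (n Γ) → Carrier) → Phase → Phase
  lmul f H i j = (f i ⁻¹) ∙ H i j

  rmul : Phase → (Fin (m Γ) → Carrier) → Phase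
  rmul H g i j = H i j ∙ g j

  _∼r_ : Phase → Phase → Set (c ⊔ ℓ)
  H₁ ∼r H₂ = Σ (Fin (m Γ) → Carrier) λ g → H₁ ≈ₕ rmul H₂ g

  _∼l_ : Phase → Phase → Set (c ⊔ ℓ)
  H₁ ∼l H₂ = Σ (Fin (n Γ) → Carrier) λ f → H₁ ≈ₕ lmul f H₂

  InStab : Phase → (Fin (n Γ) → Carrier) → (Fin (m Γ) → Carrier) → Set ℓ
  InStab H f g = lmul f (rmul H g) ≈ₕ H

  Ψ : Carrier → Phase → (i j : Fin (n Γ)) (k : Fin (m Γ)) → Carrier
  Ψ s₁ H i j k = s₁ ∙ (H i k ∙ H j k ⁻¹)

  ΨEq : Carrier → Phase → Phase → Set ℓ
  ΨEq s₁ H₁ H₂ = ∀ i j k → ¬ (i ≡ j) → _∈ₑ_ Γ i k → _∈ₑ_ Γ j k →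
    Ψ s₁ H₁ i j k ≈ Ψ s₁ H₂ i j k

  ΨL : Carrier → Phase → (i j : Fin (m Γ)) (k : Fin (n Γ)) → Carrier
  ΨL s₂ H i j k = s₂ ∙ (H k i ⁻¹ ∙ H k j)

  ΨLEq : Carrier → Phase → Phase → Set ℓ
  ΨLEq s₂ H₁ H₂ = ∀ i j k → ¬ (i ≡ j) → _∈ₑ_ Γ k i → _∈ₑ_ Γ k j →
    ΨL s₂ H₁ i j k ≈ ΨL s₂ H₂ i j k

  Central : Carrier → Set (c ⊔ ℓ)
  Central s = ∀ x → s ∙ x ≈ x ∙ s

  Involutive : Carrier → Set ℓ
  Involutive s = s ∙ s ≈ ε

-- Ψ(H) only sees the quotients H_{i,k} H_{j,k}⁻¹ inside a column of H, and
-- these determine H up to right multiplication by a diagonal matrix: fix one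
-- endpoint a of e_k and take g_k = H₂_{a,k}⁻¹ H₁_{a,k}. Dually Ψ_L(H) sees
-- the quotients H_{k,i}⁻¹ H_{k,j} inside a row, which determine H up to left
-- multiplication, provided every vertex lies on an edge (true in a connected
-- graph with an edge). This gives (1) ⇔ (2). Conditions (3) and (4) only
-- repackage (2): from H₁ = f̲* H₂ = H₂ g̲ one gets H₂ = (f̲⁻¹)* H₁ = H₁ g̲⁻¹ with
-- (f⁻¹, g) and (f, g⁻¹) in St_{l×r}(H₁), and conversely.
module Submission where

open import Defs
open import Level using (Level; _⊔_)
open import Data.Product using (_×_; Σ; ∃; _,_; proj₁; proj₂)
open import Data.Product.Algebra using (×-comm)
open import Data.Product.Function.NonDependent.Propositional using (_×-⇔_)
open import Data.Sum using (inj₁)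
open import Data.Fin using (Fin; fromℕ<; _≟_)
open import Function.Bundles using (_⇔_; mk⇔)
open import Function.Properties.Inverse using (↔⇒⇔)
open import Function.Properties.Equivalence using () renaming (trans to ⇔-trans; sym to ⇔-sym)
open import Algebra.Bundles using (Group)
open import Relation.Nullary using (yes; no)
open import Relation.Binary.Bundles using (Setoid)
open import Relation.Binary.PropositionalEquality using (refl)
import Relation.Binary.Reasoning.Setoid as SetoidReasoning

walk⇒incident : ∀ {Γ a b} → Walk Γ a b → ∃ (_∈ₑ_ Γ b) → ∃ (_∈ₑ_ Γ a)
walk⇒incident here                   b∈ = b∈
walk⇒incident (step (k , a∈k , _) _) _ = k , a∈k

connected⇒incident : ∀ {Γ} → Connected Γ → HasEdge Γ → ∀ v → ∃ (_∈ₑ_ Γ v)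
connected⇒incident {Γ} conn hasEdge v =
  walk⇒incident (conn v (proj₁ (ends Γ e))) (e , inj₁ refl)
  where e = fromℕ< hasEdge

module GroupQuotients {c ℓ : Level} (G : Group c ℓ) where
  open Group G
  open import Algebra.Properties.Group G
  open import Algebra.Properties.Monoid monoid using (cancelᶜ)
  open SetoidReasoning setoid

  x∙z//y∙z≈x//y : ∀ x y z → (x ∙ z) // (y ∙ z) ≈ x // y
  x∙z//y∙z≈x//y x y z = begin
    (x ∙ z) ∙ (y ∙ z) ⁻¹     ≈⟨ ∙-congˡ (⁻¹-anti-homo-∙ y z) ⟩
    (x ∙ z) ∙ (z ⁻¹ ∙ y ⁻¹) ≈⟨ cancelᶜ (inverseʳ z) x (y ⁻¹) ⟩
    x ∙ y ⁻¹                ∎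

  z∙x\\z∙y≈x\\y : ∀ x y z → (z ∙ x) \\ (z ∙ y) ≈ x \\ y
  z∙x\\z∙y≈x\\y x y z = begin
    (z ∙ x) ⁻¹ ∙ (z ∙ y)     ≈⟨ ∙-congʳ (⁻¹-anti-homo-∙ z x) ⟩
    (x ⁻¹ ∙ z ⁻¹) ∙ (z ∙ y) ≈⟨ cancelᶜ (inverseˡ z) (x ⁻¹) y ⟩
    x ⁻¹ ∙ y                ∎

  x//y≈u//v⇒x≈u∙v\\y : ∀ {x y u v} → x // y ≈ u // v → x ≈ u ∙ (v \\ y)
  x//y≈u//v⇒x≈u∙v\\y {x} {y} {u} {v} eq = begin
    x                ≈⟨ //-rightDividesˡ y x ⟨
    (x // y) ∙ y     ≈⟨ ∙-congʳ eq ⟩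
    (u ∙ v ⁻¹) ∙ y   ≈⟨ assoc u (v ⁻¹) y ⟩
    u ∙ (v ⁻¹ ∙ y)   ∎

  x\\y≈u\\w⇒y≈[u//x]⁻¹∙w : ∀ {x y u w} → x \\ y ≈ u \\ w → y ≈ (u // x) ⁻¹ ∙ w
  x\\y≈u\\w⇒y≈[u//x]⁻¹∙w {x} {y} {u} {w} eq = begin
    y                   ≈⟨ \\-leftDividesˡ x y ⟨
    x ∙ (x \\ y)        ≈⟨ ∙-congˡ eq ⟩
    x ∙ (u ⁻¹ ∙ w)      ≈⟨ assoc x (u ⁻¹) w ⟨
    (x // u) ∙ w        ≈⟨ ∙-congʳ (⁻¹-anti-homo-// u x) ⟨
    (u // x) ⁻¹ ∙ w     ∎

  x//x≈y//y : ∀ x y → x // x ≈ y // y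
  x//x≈y//y x y = trans (inverseʳ x) (sym (inverseʳ y))

  x\\x≈y\\y : ∀ x y → x \\ x ≈ y \\ y
  x\\x≈y\\y x y = trans (inverseˡ x) (sym (inverseˡ y))

module PhaseLemmas {c ℓ : Level} (Γ : Graph) (G : Group c ℓ) where
  open Phases Γ G renaming (refl to ≈-refl)
  open GroupQuotients G
  open import Algebra.Properties.Group G using (∙-cancelˡ; y≈x\\z; x≈z//y; //-cong₂; \\-cong₂)

  _⁻¹ᶠ : {I : Set} → (I → Carrier) → I → Carrier
  (f ⁻¹ᶠ) i = f i ⁻¹

  ≈ₕ-setoid : Setoid c ℓ
  ≈ₕ-setoid = record
    { Carrier       = Phase
    ; _≈_           = _≈ₕ_
    ; isEquivalence = record
      { refl  = λ _ _ _ → ≈-refl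
      ; sym   = λ e i j p → sym (e i j p)
      ; trans = λ e e′ i j p → trans (e i j p) (e′ i j p)
      }
    }

  lmul-cong : ∀ f {H₁ H₂} → H₁ ≈ₕ H₂ → lmul f H₁ ≈ₕ lmul f H₂
  lmul-cong f e i j p = ∙-congˡ (e i j p)

  rmul-cong : ∀ {H₁ H₂} g → H₁ ≈ₕ H₂ → rmul H₁ g ≈ₕ rmul H₂ g
  rmul-cong g e i j p = ∙-congʳ (e i j p)

  lmul-rmul-assoc : ∀ f H g → lmul f (rmul H g) ≈ₕ rmul (lmul f H) g
  lmul-rmul-assoc f H g i j _ = sym (assoc (f i ⁻¹) (H i j) (g j))

  lmul-sym : ∀ {H₁ H₂} f → H₁ ≈ₕ lmul f H₂ → H₂ ≈ₕ lmul (f ⁻¹ᶠ) H₁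
  lmul-sym {H₁} {H₂} f e i j p = y≈x\\z (f i ⁻¹) (H₂ i j) (H₁ i j) (sym (e i j p))

  rmul-sym : ∀ {H₁ H₂} g → H₁ ≈ₕ rmul H₂ g → H₂ ≈ₕ rmul H₁ (g ⁻¹ᶠ)
  rmul-sym {H₁} {H₂} g e i j p = x≈z//y (H₂ i j) (g j) (H₁ i j) (sym (e i j p))

  ColumnQuotientsAgree : Phase → Phase → Set ℓ
  ColumnQuotientsAgree H₁ H₂ = ∀ i j k → _∈ₑ_ Γ i k → _∈ₑ_ Γ j k →
    H₁ i k // H₁ j k ≈ H₂ i k // H₂ j k

  RowQuotientsAgree : Phase → Phase → Set ℓ
  RowQuotientsAgree H₁ H₂ = ∀ i j k → _∈ₑ_ Γ k i → _∈ₑ_ Γ k j →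
    H₁ k i \\ H₁ k j ≈ H₂ k i \\ H₂ k j

  ΨEq⇔ColumnQuotientsAgree : ∀ s {H₁ H₂} → ΨEq s H₁ H₂ ⇔ ColumnQuotientsAgree H₁ H₂
  ΨEq⇔ColumnQuotientsAgree s {H₁} {H₂} = mk⇔ to (λ q i j k _ p p′ → ∙-congˡ (q i j k p p′))
    where
    to : ΨEq s H₁ H₂ → ColumnQuotientsAgree H₁ H₂
    to ψ i j k p p′ with i ≟ j
    ... | yes refl = x//x≈y//y (H₁ i k) (H₂ i k)
    ... | no i≢j   = ∙-cancelˡ s _ _ (ψ i j k i≢j p p′)

  ΨLEq⇔RowQuotientsAgree : ∀ s {H₁ H₂} → ΨLEq s H₁ H₂ ⇔ RowQuotientsAgree H₁ H₂
  ΨLEq⇔RowQuotientsAgree s {H₁} {H₂} = mk⇔ to (λ q i j k _ p p′ → ∙-congˡ (q i j k p p′))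
    where
    to : ΨLEq s H₁ H₂ → RowQuotientsAgree H₁ H₂
    to ψ i j k p p′ with i ≟ j
    ... | yes refl = x\\x≈y\\y (H₁ k i) (H₂ k i)
    ... | no i≢j   = ∙-cancelˡ s _ _ (ψ i j k i≢j p p′)

  ∼r⇔ColumnQuotientsAgree : ∀ {H₁ H₂} → H₁ ∼r H₂ ⇔ ColumnQuotientsAgree H₁ H₂
  ∼r⇔ColumnQuotientsAgree {H₁} {H₂} = mk⇔ to from
    where
    to : H₁ ∼r H₂ → ColumnQuotientsAgree H₁ H₂
    to (g , e) i j k p p′ =
      trans (//-cong₂ (e i k p) (e j k p′)) (x∙z//y∙z≈x//y (H₂ i k) (H₂ j k) (g k))

    from : ColumnQuotientsAgree H₁ H₂ → H₁ ∼r H₂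
    from q = g , λ i k p → x//y≈u//v⇒x≈u∙v\\y (q i (a k) k p (inj₁ refl))
      where
      a : Fin (m Γ) → Fin (n Γ)
      a k = proj₁ (ends Γ k)
      g : Fin (m Γ) → Carrier
      g k = H₂ (a k) k \\ H₁ (a k) k

  ∼l⇒RowQuotientsAgree : ∀ {H₁ H₂} → H₁ ∼l H₂ → RowQuotientsAgree H₁ H₂
  ∼l⇒RowQuotientsAgree {H₁} {H₂} (f , e) i j k p p′ =
    trans (\\-cong₂ (e k i p) (e k j p′)) (z∙x\\z∙y≈x\\y (H₂ k i) (H₂ k j) (f k ⁻¹))

  RowQuotientsAgree⇒∼l : (∀ v → ∃ (_∈ₑ_ Γ v)) →
    ∀ {H₁ H₂} → RowQuotientsAgree H₁ H₂ → H₁ ∼l H₂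
  RowQuotientsAgree⇒∼l incident {H₁} {H₂} q = f , λ v j p →
    x\\y≈u\\w⇒y≈[u//x]⁻¹∙w (q (e v) j v (proj₂ (incident v)) p)
    where
    e : Fin (n Γ) → Fin (m Γ)
    e v = proj₁ (incident v)
    f : Fin (n Γ) → Carrier
    f v = H₂ v (e v) // H₁ v (e v)

  ΨEq⇔∼r : ∀ s {H₁ H₂} → ΨEq s H₁ H₂ ⇔ H₁ ∼r H₂
  ΨEq⇔∼r s = ⇔-trans (ΨEq⇔ColumnQuotientsAgree s) (⇔-sym ∼r⇔ColumnQuotientsAgree)

  ΨLEq⇔∼l : (∀ v → ∃ (_∈ₑ_ Γ v)) → ∀ s {H₁ H₂} → ΨLEq s H₁ H₂ ⇔ H₁ ∼l H₂
  ΨLEq⇔∼l incident s = ⇔-trans (ΨLEq⇔RowQuotientsAgree s)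
    (mk⇔ (RowQuotientsAgree⇒∼l incident) ∼l⇒RowQuotientsAgree)

  StabilizerLeftTranslate : Phase → Phase → Set (c ⊔ ℓ)
  StabilizerLeftTranslate H₁ H₂ =
    Σ (Fin (n Γ) → Carrier) λ f → Σ (Fin (m Γ) → Carrier) λ g →
      InStab H₁ f g × H₂ ≈ₕ lmul f H₁

  StabilizerRightTranslate : Phase → Phase → Set (c ⊔ ℓ)
  StabilizerRightTranslate H₁ H₂ =
    Σ (Fin (n Γ) → Carrier) λ f → Σ (Fin (m Γ) → Carrier) λ g →
      InStab H₁ f g × H₂ ≈ₕ rmul H₁ g

  ∼l×∼r⇔StabilizerLeftTranslate : ∀ {H₁ H₂} →
    (H₁ ∼l H₂ × H₁ ∼r H₂) ⇔ StabilizerLeftTranslate H₁ H₂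
  ∼l×∼r⇔StabilizerLeftTranslate {H₁} {H₂} = mk⇔ to from
    where
    open SetoidReasoning ≈ₕ-setoid

    to : H₁ ∼l H₂ × H₁ ∼r H₂ → StabilizerLeftTranslate H₁ H₂
    to ((f , l) , (g , r)) = f ⁻¹ᶠ , g , stab , lmul-sym f l
      where
      stab : InStab H₁ (f ⁻¹ᶠ) g
      stab = begin
        lmul (f ⁻¹ᶠ) (rmul H₁ g)  ≈⟨ lmul-rmul-assoc (f ⁻¹ᶠ) H₁ g ⟩
        rmul (lmul (f ⁻¹ᶠ) H₁) g  ≈⟨ rmul-cong g (lmul-sym f l) ⟨
        rmul H₂ g                 ≈⟨ r ⟨
        H₁                        ∎

    from : StabilizerLeftTranslate H₁ H₂ → H₁ ∼l H₂ × H₁ ∼r H₂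
    from (f , g , stab , l) = (f ⁻¹ᶠ , lmul-sym f l) , (g , r)
      where
      r : H₁ ≈ₕ rmul H₂ g
      r = begin
        H₁                   ≈⟨ stab ⟨
        lmul f (rmul H₁ g)   ≈⟨ lmul-rmul-assoc f H₁ g ⟩
        rmul (lmul f H₁) g   ≈⟨ rmul-cong g l ⟨
        rmul H₂ g            ∎

  ∼l×∼r⇔StabilizerRightTranslate : ∀ {H₁ H₂} →
    (H₁ ∼l H₂ × H₁ ∼r H₂) ⇔ StabilizerRightTranslate H₁ H₂
  ∼l×∼r⇔StabilizerRightTranslate {H₁} {H₂} = mk⇔ to from
    where
    open SetoidReasoning ≈ₕ-setoid

    to : H₁ ∼l H₂ × H₁ ∼r H₂ → StabilizerRightTranslate H₁ H₂
    to ((f , l) , (g , r)) = f , g ⁻¹ᶠ , stab , rmul-sym g r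
      where
      stab : InStab H₁ f (g ⁻¹ᶠ)
      stab = begin
        lmul f (rmul H₁ (g ⁻¹ᶠ))  ≈⟨ lmul-cong f (rmul-sym g r) ⟨
        lmul f H₂                 ≈⟨ l ⟨
        H₁                        ∎

    from : StabilizerRightTranslate H₁ H₂ → H₁ ∼l H₂ × H₁ ∼r H₂
    from (f , g , stab , r) = (f , l) , (g ⁻¹ᶠ , rmul-sym g r)
      where
      l : H₁ ≈ₕ lmul f H₂
      l = begin
        H₁                   ≈⟨ stab ⟨
        lmul f (rmul H₁ g)   ≈⟨ lmul-cong f r ⟨
        lmul f H₂            ∎

corollary4p22 : {c ℓ : Level} (Γ : Graph) → Simple Γ → Connected Γ → HasEdge Γ →
    (G : Group c ℓ) → let open Phases Γ G in
    (s₁ s₂ : Carrier) → Central s₁ → Central s₂ → Involutive s₁ → Involutive s₂ →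
    (H₁ H₂ : Phase) →
    let C1 = ΨEq s₁ H₁ H₂ × ΨLEq s₂ H₁ H₂
        C2 = H₁ ∼l H₂ × H₁ ∼r H₂
        C3 = Σ (Fin (n Γ) → Carrier) λ f → Σ (Fin (m Γ) → Carrier) λ g →
               InStab H₁ f g × H₂ ≈ₕ lmul f H₁
        C4 = Σ (Fin (n Γ) → Carrier) λ f → Σ (Fin (m Γ) → Carrier) λ g →
               InStab H₁ f g × H₂ ≈ₕ rmul H₁ g
    in (C1 ⇔ C2) × (C2 ⇔ C3) × (C3 ⇔ C4)
corollary4p22 Γ _ conn hasEdge G s₁ s₂ _ _ _ _ H₁ H₂ =
    ⇔-trans (ΨEq⇔∼r s₁ ×-⇔ ΨLEq⇔∼l (connected⇒incident conn hasEdge) s₂) (↔⇒⇔ (×-comm _ _))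
  , ∼l×∼r⇔StabilizerLeftTranslate
  , ⇔-trans (⇔-sym ∼l×∼r⇔StabilizerLeftTranslate) ∼l×∼r⇔StabilizerRightTranslate
  where open PhaseLemmas Γ G
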